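{- Let $\mathcal{M}=(E,r,m)$ be a ranked set with multiplicity over $R=\mathbb{R}$, and for an rsm $\mathcal{N}=(E',r',m')$ let $W_{\mathcal{N}}(x,y)=\sum_{A\subseteq E'}m'(A)x^{r'(A)}y^{|A|-r'(A)}$ be its rank-nullity polynomial. For $p_e\in[0,1]$, $$\mathbb{E}\bigl[W_{\mathcal{M}|E_{\underline p}}(x,y)\bigr]=\mathbf{Z}_{\mathcal{M}}\bigl(y/x,(p_ey)_{e\in E}\bigr).$$
   Context: A ranked set with multiplicity (rsm) is $\mathcal{M}=(E,r,m)$ with $E$ finite, $r:2^E\to\mathbb{Z}$ arbitrary, $m:2^E\to R$ arbitrary. $\mathbf{Z}_{\mathcal{M}}(q,(v_e))=\sum_{A\subseteq E}m(A)q^{ -r(A)}\prod_{e\in A}v_e$. Restriction $\mathcal{M}|A=(A,r|_{2^A},m|_{2^A})$. $E_{\underline p}$ is the random subset containing each $e$ independently with probability $p_e$. -}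

module Defs where

open import Level using (Level)
open import Algebra.Bundles using (CommutativeRing)
open import Data.Nat using (ℕ; zero; suc)
open import Data.Integer using (ℤ; +_; -[1+_]) renaming (_-_ to _-ℤ_)
open import Data.Bool using (Bool; true; false; if_then_else_)
open import Data.Fin using (Fin)
open import Data.Fin.Subset using (Subset; ∣_∣; _∈_)
open import Data.Vec using (Vec; []; _∷_; lookup)
open import Data.List using (List; []; _∷_; map; _++_)

subsetsOf : ∀ {n} → Subset n → List (Subset n)
subsetsOf [] = [] ∷ []
subsetsOf (false ∷ A) = map (false ∷_) (subsetsOf A)
subsetsOf (true ∷ A) = map (false ∷_) (subsetsOf A) ++ map (true ∷_) (subsetsOf A)

-- A ranked set with multiplicity whose ground set is a subset of Fin n.
-- rank and mult are arbitrary functions on subsets (only values on subsets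
-- of the ground set matter).
record RSM {c : Level} (C : Set c) (n : ℕ) : Set c where
  field
    ground : Subset n
    rank   : Subset n → ℤ
    mult   : Subset n → C

restrict : ∀ {c} {C : Set c} {n} → RSM C n → Subset n → RSM C n
restrict M A = record { ground = A ; rank = RSM.rank M ; mult = RSM.mult M }

module WithRing {c ℓ} (R : CommutativeRing c ℓ) where
  open CommutativeRing R

  pow : Carrier → ℕ → Carrier
  pow x zero = 1#
  pow x (suc k) = x * pow x k

  -- integer powers of a unit x with chosen inverse xinv
  zpow : Carrier → Carrier → ℤ → Carrier
  zpow x xinv (+ k) = pow x k
  zpow x xinv -[1+ k ] = pow xinv (suc k)

  sumL : List Carrier → Carrier
  sumL [] = 0#
  sumL (a ∷ as) = a + sumL as

  prodFin : ∀ {n} → (Fin n → Carrier) → Carrier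
  prodFin {zero} f = 1#
  prodFin {suc n} f = f Fin.zero * prodFin (λ i → f (Fin.suc i))

  prodOver : ∀ {n} → Subset n → (Fin n → Carrier) → Carrier
  prodOver A v = prodFin (λ e → if lookup A e then v e else 1#)

  -- Multivariate Tutte polynomial Z_M(q, v), with q a unit (inverse qinv):
  -- Σ_{A ⊆ E} m(A) q^{-r(A)} ∏_{e∈A} v_e
  Z : ∀ {n} → RSM Carrier n → (q qinv : Carrier) → (Fin n → Carrier) → Carrier
  Z M q qinv v = sumL (map (λ A → RSM.mult M A * (zpow q qinv (Data.Integer.- RSM.rank M A) * prodOver A v))
                           (subsetsOf (RSM.ground M)))

  W : ∀ {n} → RSM Carrier n → (x xinv y yinv : Carrier) → Carrier
  W N x xinv y yinv = sumL (map (λ A → RSM.mult N A * (zpow x xinv (RSM.rank N A)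
                                   * zpow y yinv ((+ ∣ A ∣) -ℤ RSM.rank N A)))
                               (subsetsOf (RSM.ground N)))

  -- Probability that the random subset E_p of E equals S (for S ⊆ E):
  -- ∏_{e ∈ S} p_e ∏_{e ∈ E \ S} (1 - p_e)
  prob : ∀ {n} → Subset n → (Fin n → Carrier) → Subset n → Carrier
  prob E p S = prodFin (λ e → if lookup S e then p e
                              else (if lookup E e then 1# - p e else 1#))

  expect : ∀ {n} → Subset n → (Fin n → Carrier) → (Subset n → Carrier) → Carrier
  expect E p f = sumL (map (λ S → prob E p S * f S) (subsetsOf E))

module Submission where

-- Unfolding W, the left-hand side is E[ Σ_{A ⊆ E_p} g(A) ] with
-- g(A) = m(A) x^{r(A)} y^{|A|-r(A)}.  Exchanging expectation and summation,
-- A ⊆ E_p happens with probability ∏_{e∈A} p_e, so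
--     E[ Σ_{A ⊆ E_p} g(A) ] = Σ_{A ⊆ E} (∏_{e∈A} p_e) g(A)          (expect-downSum)
-- which is proved by induction on the ground set, conditioning on the first
-- coordinate (expect-false / expect-true and the analogous weightedSum
-- decompositions).  Termwise, x^r y^{|A|-r} = (y/x)^{-r} y^{|A|} (monomial-shift)
-- and (∏_{e∈A} p_e) y^{|A|} = ∏_{e∈A} p_e y (prodOver-scale), which turns each
-- summand into the corresponding summand of Z_M(y/x, (p_e y)).

open import Defs
open import Algebra.Bundles using (CommutativeRing)
open import Data.Nat using (ℕ; zero; suc)
open import Data.Fin using (Fin)
import Data.Fin as F
open import Data.Bool using (true; false)
open import Data.Vec using ([]; _∷_)
open import Data.List using (List; []; _∷_; map; _++_)
open import Data.Integer as ℤ using (ℤ; +_; -[1+_])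
import Data.Integer.Properties as ℤP
open import Relation.Binary.PropositionalEquality as P using (_≡_)
open import Data.Fin.Subset using (Subset; ∣_∣)
import Algebra.Properties.CommutativeSemigroup as CSP

module Proof {c ℓ} (R : CommutativeRing c ℓ) where
  open CommutativeRing R
  open WithRing R
  open import Relation.Binary.Reasoning.Setoid setoid
  open CSP +-commutativeSemigroup using () renaming (interchange to +-interchange)
  open CSP *-commutativeSemigroup using () renaming (interchange to *-interchange)

  ≡⇒≈ : ∀ {a b} → a ≡ b → a ≈ b
  ≡⇒≈ P.refl = refl

  ∑ : ∀ {A : Set} → List A → (A → Carrier) → Carrier
  ∑ xs f = sumL (map f xs)

  ∑-cong : ∀ {A : Set} (xs : List A) {f g : A → Carrier} →
           (∀ a → f a ≈ g a) → ∑ xs f ≈ ∑ xs g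
  ∑-cong []       f≈g = refl
  ∑-cong (x ∷ xs) f≈g = +-cong (f≈g x) (∑-cong xs f≈g)

  ∑-map : ∀ {A B : Set} (k : A → B) (xs : List A) (f : B → Carrier) →
          ∑ (map k xs) f ≡ ∑ xs (λ a → f (k a))
  ∑-map k []       f = P.refl
  ∑-map k (x ∷ xs) f = P.cong (λ t → f (k x) + t) (∑-map k xs f)

  ∑-++ : ∀ {A : Set} (xs ys : List A) (f : A → Carrier) → ∑ (xs ++ ys) f ≈ ∑ xs f + ∑ ys f
  ∑-++ []       ys f = sym (+-identityˡ _)
  ∑-++ (x ∷ xs) ys f = trans (+-congˡ (∑-++ xs ys f)) (sym (+-assoc _ _ _))

  ∑-+ : ∀ {A : Set} (xs : List A) (f g : A → Carrier) →
        ∑ xs (λ a → f a + g a) ≈ ∑ xs f + ∑ xs g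
  ∑-+ []       f g = sym (+-identityˡ 0#)
  ∑-+ (x ∷ xs) f g = trans (+-congˡ (∑-+ xs f g)) (+-interchange _ _ _ _)

  ∑-*ˡ : ∀ {A : Set} (xs : List A) (k : Carrier) (f : A → Carrier) →
         ∑ xs (λ a → k * f a) ≈ k * ∑ xs f
  ∑-*ˡ []       k f = sym (zeroʳ k)
  ∑-*ˡ (x ∷ xs) k f = trans (+-congˡ (∑-*ˡ xs k f)) (sym (distribˡ k _ _))

  ∑-subsets-false : ∀ {n} (A : Subset n) (f : Subset (suc n) → Carrier) →
    ∑ (subsetsOf (false ∷ A)) f ≈ ∑ (subsetsOf A) (λ B → f (false ∷ B))
  ∑-subsets-false A f = ≡⇒≈ (∑-map (false ∷_) (subsetsOf A) f)

  ∑-subsets-true : ∀ {n} (A : Subset n) (f : Subset (suc n) → Carrier) →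
    ∑ (subsetsOf (true ∷ A)) f ≈ ∑ (subsetsOf A) (λ B → f (false ∷ B)) + ∑ (subsetsOf A) (λ B → f (true ∷ B))
  ∑-subsets-true A f = trans (∑-++ (map (false ∷_) L) (map (true ∷_) L) f)
                             (≡⇒≈ (P.cong₂ _+_ (∑-map (false ∷_) L f) (∑-map (true ∷_) L f)))
    where L = subsetsOf A

  pow-cong : ∀ {a b} k → a ≈ b → pow a k ≈ pow b k
  pow-cong zero    a≈b = refl
  pow-cong (suc k) a≈b = *-cong a≈b (pow-cong k a≈b)

  pow-* : ∀ a b k → pow (a * b) k ≈ pow a k * pow b k
  pow-* a b zero    = sym (*-identityˡ 1#)
  pow-* a b (suc k) = trans (*-congˡ (pow-* a b k)) (*-interchange a b (pow a k) (pow b k))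

  zpow-cong : ∀ {a b ai bi} k → a ≈ b → ai ≈ bi → zpow a ai k ≈ zpow b bi k
  zpow-cong (+ k)    a≈b ai≈bi = pow-cong k a≈b
  zpow-cong -[1+ k ] a≈b ai≈bi = pow-cong (suc k) ai≈bi

  zpow-* : ∀ a ai b bi k → zpow (a * b) (ai * bi) k ≈ zpow a ai k * zpow b bi k
  zpow-* a ai b bi (+ k)    = pow-* a b k
  zpow-* a ai b bi -[1+ k ] = pow-* ai bi (suc k)

  zpow-neg : ∀ a ai k → zpow a ai k ≡ zpow ai a (ℤ.- k)
  zpow-neg a ai (+ zero)  = P.refl
  zpow-neg a ai (+ suc k) = P.refl
  zpow-neg a ai -[1+ k ]  = P.refl

  module Unit (a ai : Carrier) (a*ai≈1 : a * ai ≈ 1#) where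
    cancelˡ : ∀ z → a * (ai * z) ≈ z
    cancelˡ z = trans (sym (*-assoc a ai z)) (trans (*-congʳ a*ai≈1) (*-identityˡ z))

    cancelʳ : ∀ z → ai * (a * z) ≈ z
    cancelʳ z = trans (sym (*-assoc ai a z))
                      (trans (*-congʳ (trans (*-comm ai a) a*ai≈1)) (*-identityˡ z))

    zpow-suc : ∀ j → zpow a ai (+ 1 ℤ.+ j) ≈ a * zpow a ai j
    zpow-suc (+ k)          = refl
    zpow-suc -[1+ zero ]    = sym (cancelˡ 1#)
    zpow-suc -[1+ suc k ]   = sym (cancelˡ (pow ai (suc k)))

    zpow-pred : ∀ j → zpow a ai (-[1+ 0 ] ℤ.+ j) ≈ ai * zpow a ai j
    zpow-pred (+ zero)  = refl
    zpow-pred (+ suc k) = sym (cancelʳ (pow a k))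
    zpow-pred -[1+ k ]  = refl

    zpow-+ : ∀ i j → zpow a ai (i ℤ.+ j) ≈ zpow a ai i * zpow a ai j
    zpow-+ (+ zero) j =
      trans (≡⇒≈ (P.cong (zpow a ai) (ℤP.+-identityˡ j))) (sym (*-identityˡ _))
    zpow-+ (+ suc m) j = begin
      zpow a ai (+ suc m ℤ.+ j)         ≡⟨ P.cong (zpow a ai) (ℤP.+-assoc (+ 1) (+ m) j) ⟩
      zpow a ai (+ 1 ℤ.+ (+ m ℤ.+ j))   ≈⟨ zpow-suc (+ m ℤ.+ j) ⟩
      a * zpow a ai (+ m ℤ.+ j)         ≈⟨ *-congˡ (zpow-+ (+ m) j) ⟩
      a * (pow a m * zpow a ai j)       ≈⟨ sym (*-assoc _ _ _) ⟩
      a * pow a m * zpow a ai j         ∎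
    zpow-+ -[1+ zero ] j = trans (zpow-pred j) (*-congʳ (sym (*-identityʳ ai)))
    zpow-+ -[1+ suc m ] j = begin
      zpow a ai (-[1+ suc m ] ℤ.+ j)             ≡⟨ P.cong (zpow a ai) (ℤP.+-assoc -[1+ 0 ] -[1+ m ] j) ⟩
      zpow a ai (-[1+ 0 ] ℤ.+ (-[1+ m ] ℤ.+ j))  ≈⟨ zpow-pred (-[1+ m ] ℤ.+ j) ⟩
      ai * zpow a ai (-[1+ m ] ℤ.+ j)            ≈⟨ *-congˡ (zpow-+ -[1+ m ] j) ⟩
      ai * (pow ai (suc m) * zpow a ai j)        ≈⟨ sym (*-assoc _ _ _) ⟩
      ai * pow ai (suc m) * zpow a ai j          ∎

  monomial-shift : ∀ x xinv y yinv → y * yinv ≈ 1# → ∀ (r : ℤ) (N : ℕ) →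
    zpow x xinv r * zpow y yinv (+ N ℤ.- r) ≈ zpow (y * xinv) (x * yinv) (ℤ.- r) * pow y N
  monomial-shift x xinv y yinv y*yinv≈1 r N = begin
    zpow x xinv r * zpow y yinv (+ N ℤ.- r)                 ≡⟨ P.cong (λ k → zpow x xinv r * zpow y yinv k) (ℤP.+-comm (+ N) (ℤ.- r)) ⟩
    zpow x xinv r * zpow y yinv (ℤ.- r ℤ.+ + N)             ≈⟨ *-congˡ (zpow-+ (ℤ.- r) (+ N)) ⟩
    zpow x xinv r * (zpow y yinv (ℤ.- r) * pow y N)         ≈⟨ sym (*-assoc _ _ _) ⟩
    zpow x xinv r * zpow y yinv (ℤ.- r) * pow y N           ≈⟨ *-congʳ (*-comm _ _) ⟩
    zpow y yinv (ℤ.- r) * zpow x xinv r * pow y N           ≡⟨ P.cong (λ t → zpow y yinv (ℤ.- r) * t * pow y N) (zpow-neg x xinv r) ⟩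
    zpow y yinv (ℤ.- r) * zpow xinv x (ℤ.- r) * pow y N     ≈⟨ *-congʳ (sym (zpow-* y yinv xinv x (ℤ.- r))) ⟩
    zpow (y * xinv) (yinv * x) (ℤ.- r) * pow y N            ≈⟨ *-congʳ (zpow-cong (ℤ.- r) refl (*-comm yinv x)) ⟩
    zpow (y * xinv) (x * yinv) (ℤ.- r) * pow y N            ∎
    where open Unit y yinv y*yinv≈1

  prodOver-scale : ∀ {n} (A : Subset n) (v : Fin n → Carrier) (y : Carrier) →
    prodOver A (λ e → v e * y) ≈ prodOver A v * pow y ∣ A ∣
  prodOver-scale []          v y = sym (*-identityˡ 1#)
  prodOver-scale (false ∷ A) v y =
    trans (*-congˡ (prodOver-scale A (λ e → v (F.suc e)) y)) (sym (*-assoc _ _ _))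
  prodOver-scale (true ∷ A)  v y =
    trans (*-congˡ (prodOver-scale A (λ e → v (F.suc e)) y)) (*-interchange _ _ _ _)

  -- Conditioning on the first coordinate: an element outside the ground set
  -- never lies in E_p, and an element of the ground set lies in it with
  -- probability p₀ (law of total expectation).
  expect-false : ∀ {n} (E : Subset n) (p : Fin (suc n) → Carrier) (f : Subset (suc n) → Carrier) →
    expect (false ∷ E) p f ≈ expect E (λ i → p (F.suc i)) (λ S → f (false ∷ S))
  expect-false E p f = trans (∑-subsets-false E _)
                             (∑-cong (subsetsOf E) (λ S → *-congʳ (*-identityˡ _)))

  expect-true : ∀ {n} (E : Subset n) (p : Fin (suc n) → Carrier) (f : Subset (suc n) → Carrier) →
    expect (true ∷ E) p f
      ≈ (1# - p F.zero) * expect E (λ i → p (F.suc i)) (λ S → f (false ∷ S))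
        + p F.zero * expect E (λ i → p (F.suc i)) (λ S → f (true ∷ S))
  expect-true E p f = trans (∑-subsets-true E _)
    (+-cong (trans (∑-cong L (λ S → *-assoc _ _ _)) (∑-*ˡ L _ _))
            (trans (∑-cong L (λ S → *-assoc _ _ _)) (∑-*ˡ L _ _)))
    where L = subsetsOf E

  weightedSum : ∀ {n} → Subset n → (Fin n → Carrier) → (Subset n → Carrier) → Carrier
  weightedSum E p g = ∑ (subsetsOf E) (λ A → prodOver A p * g A)

  weightedSum-false : ∀ {n} (E : Subset n) (p : Fin (suc n) → Carrier) (g : Subset (suc n) → Carrier) →
    weightedSum (false ∷ E) p g ≈ weightedSum E (λ i → p (F.suc i)) (λ A → g (false ∷ A))
  weightedSum-false E p g = trans (∑-subsets-false E _)
                                  (∑-cong (subsetsOf E) (λ A → *-congʳ (*-identityˡ _)))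

  weightedSum-true : ∀ {n} (E : Subset n) (p : Fin (suc n) → Carrier) (g : Subset (suc n) → Carrier) →
    weightedSum (true ∷ E) p g
      ≈ weightedSum E (λ i → p (F.suc i)) (λ A → g (false ∷ A))
        + p F.zero * weightedSum E (λ i → p (F.suc i)) (λ A → g (true ∷ A))
  weightedSum-true E p g = trans (∑-subsets-true E _)
    (+-cong (∑-cong L (λ A → *-congʳ (*-identityˡ _)))
            (trans (∑-cong L (λ A → *-assoc _ _ _)) (∑-*ˡ L _ _)))
    where L = subsetsOf E

  mix : ∀ q X Y → (1# - q) * X + q * (X + Y) ≈ X + q * Y
  mix q X Y = begin
    (1# - q) * X + q * (X + Y)        ≈⟨ +-congˡ (distribˡ q X Y) ⟩
    (1# - q) * X + (q * X + q * Y)    ≈⟨ sym (+-assoc _ _ _) ⟩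
    ((1# - q) * X + q * X) + q * Y    ≈⟨ +-congʳ (sym (distribʳ X _ _)) ⟩
    ((1# - q) + q) * X + q * Y        ≈⟨ +-congʳ (*-congʳ (trans (+-assoc _ _ _) (trans (+-congˡ (-‿inverseˡ q)) (+-identityʳ 1#)))) ⟩
    1# * X + q * Y                    ≈⟨ +-congʳ (*-identityˡ X) ⟩
    X + q * Y                         ∎

  expect-downSum : ∀ {n} (E : Subset n) (p : Fin n → Carrier) (g : Subset n → Carrier) →
    expect E p (λ S → ∑ (subsetsOf S) g) ≈ weightedSum E p g
  expect-downSum []          p g = +-congʳ (*-congˡ (+-identityʳ _))
  expect-downSum (false ∷ E) p g = begin
    expect (false ∷ E) p (λ S → ∑ (subsetsOf S) g)  ≈⟨ expect-false E p _ ⟩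
    expect E p′ (λ S → ∑ (subsetsOf (false ∷ S)) g) ≈⟨ ∑-cong (subsetsOf E) (λ S → *-congˡ (∑-subsets-false S g)) ⟩
    expect E p′ (λ S → ∑ (subsetsOf S) g₀)          ≈⟨ expect-downSum E p′ g₀ ⟩
    weightedSum E p′ g₀                             ≈⟨ sym (weightedSum-false E p g) ⟩
    weightedSum (false ∷ E) p g                     ∎
    where
      p′ = λ i → p (F.suc i)
      g₀ = λ A → g (false ∷ A)
  expect-downSum (true ∷ E) p g = begin
    expect (true ∷ E) p (λ S → ∑ (subsetsOf S) g)                  ≈⟨ expect-true E p _ ⟩
    (1# - p₀) * expect E p′ (λ S → ∑ (subsetsOf (false ∷ S)) g)
      + p₀ * expect E p′ (λ S → ∑ (subsetsOf (true ∷ S)) g)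
                                                                    ≈⟨ +-cong (*-congˡ X₀-false) (*-congˡ split) ⟩
    (1# - p₀) * X₀ + p₀ * (X₀ + X₁)                                 ≈⟨ mix p₀ X₀ X₁ ⟩
    X₀ + p₀ * X₁                                                    ≈⟨ +-cong (expect-downSum E p′ g₀) (*-congˡ (expect-downSum E p′ g₁)) ⟩
    weightedSum E p′ g₀ + p₀ * weightedSum E p′ g₁                  ≈⟨ sym (weightedSum-true E p g) ⟩
    weightedSum (true ∷ E) p g                                      ∎
    where
      p₀ = p F.zero
      p′ = λ i → p (F.suc i)
      g₀ = λ A → g (false ∷ A)
      g₁ = λ A → g (true ∷ A)
      X₀ = expect E p′ (λ S → ∑ (subsetsOf S) g₀)
      X₁ = expect E p′ (λ S → ∑ (subsetsOf S) g₁)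
      X₀-false : expect E p′ (λ S → ∑ (subsetsOf (false ∷ S)) g) ≈ X₀
      X₀-false = ∑-cong (subsetsOf E) (λ S → *-congˡ (∑-subsets-false S g))
      -- a subset of true ∷ S either avoids or contains the new point
      split : expect E p′ (λ S → ∑ (subsetsOf (true ∷ S)) g) ≈ X₀ + X₁
      split = trans (∑-cong (subsetsOf E) (λ S → *-congˡ (∑-subsets-true S g)))
                    (trans (∑-cong (subsetsOf E) (λ S → distribˡ _ _ _))
                           (∑-+ (subsetsOf E) _ _))

corollary3p20 : ∀ {c ℓ} (R : CommutativeRing c ℓ) → let open CommutativeRing R in let open WithRing R in
    ∀ {n : ℕ} (M : RSM Carrier n) (p : Fin n → Carrier) (x xinv y yinv : Carrier) →
    x * xinv ≈ 1# → y * yinv ≈ 1# →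
    expect (RSM.ground M) p (λ S → W (restrict M S) x xinv y yinv)
    ≈ Z M (y * xinv) (x * yinv) (λ e → p e * y)
corollary3p20 R M p x xinv y yinv _ y*yinv≈1 =
  trans (expect-downSum (RSM.ground M) p rankNullityTerm)
        (∑-cong (subsetsOf (RSM.ground M)) termwise)
  where
    open CommutativeRing R
    open WithRing R
    open Proof R
    open CSP *-commutativeSemigroup using (x∙yz≈y∙xz)
    open import Relation.Binary.Reasoning.Setoid setoid

    rankNullityTerm : Subset _ → Carrier
    rankNullityTerm A = RSM.mult M A * (zpow x xinv (RSM.rank M A) * zpow y yinv (+ ∣ A ∣ ℤ.- RSM.rank M A))

    termwise : ∀ A → prodOver A p * rankNullityTerm A
      ≈ RSM.mult M A * (zpow (y * xinv) (x * yinv) (ℤ.- RSM.rank M A) * prodOver A (λ e → p e * y))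
    termwise A = begin
      prodOver A p * rankNullityTerm A
        ≈⟨ *-congˡ (*-congˡ (monomial-shift x xinv y yinv y*yinv≈1 (RSM.rank M A) ∣ A ∣)) ⟩
      prodOver A p * (RSM.mult M A * (zpow (y * xinv) (x * yinv) (ℤ.- RSM.rank M A) * pow y ∣ A ∣))
        ≈⟨ trans (x∙yz≈y∙xz _ _ _) (*-congˡ (x∙yz≈y∙xz _ _ _)) ⟩
      RSM.mult M A * (zpow (y * xinv) (x * yinv) (ℤ.- RSM.rank M A) * (prodOver A p * pow y ∣ A ∣))
        ≈⟨ *-congˡ (*-congˡ (sym (prodOver-scale A p y))) ⟩
      RSM.mult M A * (zpow (y * xinv) (x * yinv) (ℤ.- RSM.rank M A) * prodOver A (λ e → p e * y)) ∎
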